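{- Let $L$ be a distributive lattice. The relation $\le$ on positive simple functions $S^+(L)$ is transitive: if $\sum_i r_ia_i\le\sum_j s_jb_j$ and $\sum_j s_jb_j\le\sum_k t_kc_k$, then $\sum_i r_ia_i\le\sum_k t_kc_k$.
   Context: A positive simple function on $L$ is a finite formal sum $\sum_{i} r_ix_i$ with $x_i\in L$ and $r_i$ positive rationals. For a subset $I$ of the (finite) index set write $x_I=\bigwedge_{i\in I}x_i$ (with $x_\emptyset$ the top element) and $r_I=\sum_{i\in I}r_i$. The order is: $\sum_i r_ix_i\le\sum_j s_jy_j$ iff for every subset $I$ of the index set of the left-hand side, $x_I\le\bigvee\{y_J: J\text{ a subset of the index set of the right-hand side with } r_I\le s_J\}$. -}

module Defs where

open import Level using (Level)
open import Data.Nat using (ℕ; zero; suc)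
open import Data.Fin using (Fin; zero; suc)
open import Data.Fin.Subset using (Subset; inside; outside)
open import Data.Vec using (Vec; []; _∷_)
open import Data.List using (List; []; _∷_; map; _++_; foldr)
open import Data.Bool using (Bool; true; false; if_then_else_)
open import Data.Rational using (ℚ; 0ℚ; _+_; _≤_; _≤?_; Positive)
open import Relation.Nullary using (does)
open import Relation.Binary.Lattice.Bundles using (DistributiveLattice)

allSubsets : (n : ℕ) → List (Subset n)
allSubsets zero    = [] ∷ []
allSubsets (suc n) = map (inside ∷_) (allSubsets n) ++ map (outside ∷_) (allSubsets n)

sumOver : {n : ℕ} → (Fin n → ℚ) → Subset n → ℚ
sumOver {zero}  r []           = 0ℚ
sumOver {suc n} r (true  ∷ I)  = r zero + sumOver (λ i → r (suc i)) I
sumOver {suc n} r (false ∷ I)  = sumOver (λ i → r (suc i)) I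

record SimpleFn {c : Level} (C : Set c) : Set c where
  constructor simpleFn
  field
    size : ℕ
    coef : Fin size → ℚ
    coef-pos : (i : Fin size) → Positive (coef i)
    elem : Fin size → C

module Order {c ℓ₁ ℓ₂ : Level} (L : DistributiveLattice c ℓ₁ ℓ₂)
             (top bot : DistributiveLattice.Carrier L) where
  open DistributiveLattice L renaming (_≤_ to _≤L_)

  meetOver : {n : ℕ} → (Fin n → Carrier) → Subset n → Carrier
  meetOver {zero}  x []          = top
  meetOver {suc n} x (true  ∷ I) = x zero ∧ meetOver (λ i → x (suc i)) I
  meetOver {suc n} x (false ∷ I) = meetOver (λ i → x (suc i)) I

  joinWhere : {m : ℕ} → ℚ → (Fin m → ℚ) → (Fin m → Carrier) → List (Subset m) → Carrier
  joinWhere q s y = foldr (λ J acc → if does (q ≤? sumOver s J) then meetOver y J ∨ acc else acc) bot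

  -- Σ r_i x_i ≤ Σ s_j y_j  iff  ∀ I, x_I ≤ ⋁ { y_J : r_I ≤ s_J }
  _≼_ : SimpleFn Carrier → SimpleFn Carrier → Set ℓ₂
  f ≼ g = (I : Subset (SimpleFn.size f)) →
          meetOver (SimpleFn.elem f) I ≤L
          joinWhere (sumOver (SimpleFn.coef f) I) (SimpleFn.coef g) (SimpleFn.elem g)
                    (allSubsets (SimpleFn.size g))

-- If r_I ≤ s_J then, by the second inequality, y_J lies below ⋁{z_K : s_J ≤ t_K},
-- and this join is below ⋁{z_K : r_I ≤ t_K} because raising the threshold only
-- drops terms.  Hence every term of ⋁{y_J : r_I ≤ s_J} is below ⋁{z_K : r_I ≤ t_K},
-- and the first inequality concludes.
module Submission where

open import Defs
open import Relation.Binary.Lattice.Bundles using (DistributiveLattice)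
import Relation.Binary.Lattice.Properties.JoinSemilattice as JoinSemilatticeProperties
open import Relation.Binary.Definitions using (Maximum; Minimum)
open import Data.Bool using (if_then_else_)
open import Data.Fin using (Fin)
open import Data.Fin.Subset using (Subset)
open import Data.List using (List; []; _∷_)
open import Data.Rational using (ℚ; _≤?_) renaming (_≤_ to _≤ℚ_)
open import Data.Rational.Properties using () renaming (≤-trans to ≤ℚ-trans)
open import Relation.Nullary using (Dec; yes; no; does; contradiction)

module JoinWhere {c ℓ₁ ℓ₂} (L : DistributiveLattice c ℓ₁ ℓ₂)
                 (top bot : DistributiveLattice.Carrier L)
                 (bot-minimum : Minimum (DistributiveLattice._≤_ L) bot) where
  open DistributiveLattice L
  open JoinSemilatticeProperties joinSemilattice using (∨-monotonic)
  open Order L top bot using (meetOver; joinWhere)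

  if-∨-least : ∀ {p} {P : Set p} (d : Dec P) {u a b : Carrier} →
               (P → u ≤ b) → a ≤ b → (if does d then u ∨ a else a) ≤ b
  if-∨-least (yes p) u≤b a≤b = ∨-least (u≤b p) a≤b
  if-∨-least (no  _) _   a≤b = a≤b

  if-∨-monotonic : ∀ {p p'} {P : Set p} {P' : Set p'} (d' : Dec P') (d : Dec P) {u a a' : Carrier} →
                   (P' → P) → a' ≤ a → (if does d' then u ∨ a' else a') ≤ (if does d then u ∨ a else a)
  if-∨-monotonic (yes _)  (yes _)  _    a'≤a = ∨-monotonic refl a'≤a
  if-∨-monotonic (yes p') (no ¬p)  P'⇒P _    = contradiction (P'⇒P p') ¬p
  if-∨-monotonic (no  _)  (yes _)  _    a'≤a = trans a'≤a (y≤x∨y _ _)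
  if-∨-monotonic (no  _)  (no  _)  _    a'≤a = a'≤a

  joinWhere-least : ∀ {m} {q : ℚ} {s : Fin m → ℚ} {y : Fin m → Carrier} {a : Carrier} →
                    (∀ J → q ≤ℚ sumOver s J → meetOver y J ≤ a) →
                    (Js : List (Subset m)) → joinWhere q s y Js ≤ a
  joinWhere-least {a = a} bound [] = bot-minimum a
  joinWhere-least {q = q} {s} bound (J ∷ Js) =
    if-∨-least (q ≤? sumOver s J) (bound J) (joinWhere-least bound Js)

  joinWhere-antitone : ∀ {m} {q q' : ℚ} {s : Fin m → ℚ} {y : Fin m → Carrier} →
                       q ≤ℚ q' → (Js : List (Subset m)) →
                       joinWhere q' s y Js ≤ joinWhere q s y Js
  joinWhere-antitone q≤q' [] = refl
  joinWhere-antitone {q = q} {q'} {s} q≤q' (J ∷ Js) =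
    if-∨-monotonic (q' ≤? sumOver s J) (q ≤? sumOver s J)
                   (≤ℚ-trans q≤q') (joinWhere-antitone q≤q' Js)

lemma4p4 : ∀ {c ℓ₁ ℓ₂} (L : DistributiveLattice c ℓ₁ ℓ₂)
    (top bot : DistributiveLattice.Carrier L)
    → Maximum (DistributiveLattice._≤_ L) top
    → Minimum (DistributiveLattice._≤_ L) bot
    → (f g h : SimpleFn (DistributiveLattice.Carrier L))
    → Order._≼_ L top bot f g
    → Order._≼_ L top bot g h
    → Order._≼_ L top bot f h
lemma4p4 L top bot _ bot-minimum f g h f≼g g≼h I =
  trans (f≼g I) (joinWhere-least g-term≤h-join (allSubsets (size g)))
  where
  open DistributiveLattice L using (_≤_; trans)
  open JoinWhere L top bot bot-minimum
  open SimpleFn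
  open Order L top bot using (meetOver; joinWhere)
  rI : ℚ
  rI = sumOver (coef f) I
  g-term≤h-join : ∀ J → rI ≤ℚ sumOver (coef g) J →
                  meetOver (elem g) J ≤ joinWhere rI (coef h) (elem h) (allSubsets (size h))
  g-term≤h-join J rI≤sJ = trans (g≼h J) (joinWhere-antitone rI≤sJ (allSubsets (size h)))
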